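{- For any finite simple graph $G$ with clique number $\omega(G)$, $$\varphi(G)\leq \frac{\chi(\overline{G})^2}{2\chi(\overline{G})-1}\,\omega(G).$$
   Context: $\overline{G}$ is the complement of $G$ and $\chi$ denotes chromatic number. $\omega(G)$ is the largest order of a complete subgraph of $G$. A $b$-coloring of $G$ with $b$ colors is a proper coloring of $V(G)$ using exactly $b$ colors such that for every color $i$ there is a vertex of color $i$ having neighbors of all the other $b-1$ colors. The $b$-chromatic number $\varphi(G)$ is the largest $b$ for which such a coloring exists. -}

module Defs where

open import Level using (0ℓ)
open import Data.Nat using (ℕ; _≤_)
open import Data.Fin using (Fin)
open import Data.Product using (Σ; ∃; _×_; _,_)
open import Relation.Nullary using (¬_)
open import Relation.Binary.PropositionalEquality using (_≡_)
open import Function.Definitions using (Injective; Surjective)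

record Graph (n : ℕ) : Set₁ where
  field
    Adj   : Fin n → Fin n → Set
    sym   : ∀ {u v} → Adj u v → Adj v u
    irrefl : ∀ {v} → ¬ Adj v v
open Graph public

complement : ∀ {n} → Graph n → Graph n
complement G = record
  { Adj = λ u v → ¬ (u ≡ v) × ¬ Adj G u v
  ; sym = λ { (u≢v , ¬a) → (λ e → u≢v (Relation.Binary.PropositionalEquality.sym e))
                          , (λ a → ¬a (Graph.sym G a)) }
  ; irrefl = λ { (v≢v , _) → v≢v Relation.Binary.PropositionalEquality.refl }
  }

IsProperColoring : ∀ {n} (G : Graph n) (k : ℕ) → (Fin n → Fin k) → Set
IsProperColoring G k c = ∀ u v → Adj G u v → ¬ (c u ≡ c v)

Colorable : ∀ {n} → Graph n → ℕ → Set
Colorable G k = Σ (_ → Fin k) (IsProperColoring G k)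

IsChromaticNumber : ∀ {n} → Graph n → ℕ → Set
IsChromaticNumber G k = Colorable G k × (∀ m → Colorable G m → k ≤ m)

IsClique : ∀ {n} (G : Graph n) (k : ℕ) → (Fin k → Fin n) → Set
IsClique G k f = Injective _≡_ _≡_ f × (∀ i j → ¬ (i ≡ j) → Adj G (f i) (f j))

HasClique : ∀ {n} → Graph n → ℕ → Set
HasClique G k = Σ (_ → _) (IsClique G k)

IsCliqueNumber : ∀ {n} → Graph n → ℕ → Set
IsCliqueNumber G k = HasClique G k × (∀ m → HasClique G m → m ≤ k)

IsBColoring : ∀ {n} (G : Graph n) (b : ℕ) → (Fin n → Fin b) → Set
IsBColoring G b c =
  IsProperColoring G b c ×
  Surjective _≡_ _≡_ c ×
  (∀ i → Σ (Fin _) λ v → c v ≡ i ×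
      (∀ j → ¬ (j ≡ i) → Σ (Fin _) λ u → Adj G v u × c u ≡ j))

HasBColoring : ∀ {n} → Graph n → ℕ → Set
HasBColoring G b = Σ (_ → Fin b) (IsBColoring G b)

IsBChromaticNumber : ∀ {n} → Graph n → ℕ → Set
IsBChromaticNumber G b = HasBColoring G b × (∀ m → HasBColoring G m → m ≤ b)

{-# OPTIONS --safe #-}

-- Let c be a b-coloring of G and q a proper coloring of Ḡ with k colors. The color classes of q
-- are cliques of G, so n ≤ kω. If s color classes of c are singletons, the others have at least
-- two vertices, so 2b ≤ n + s. A singleton class consists of its dominant vertex alone, which is
-- therefore adjacent to every other dominant vertex; so for each color j of q the dominant
-- vertices that are singletons or have q-color j form a clique, and summing over j gives
-- b + (k − 1)s ≤ kω. Hence b(2k − 1) = (k − 1)·2b + b ≤ (k − 1)(n + s) + b ≤ (k − 1)kω + kω = k²ω.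

module Submission where

open import Defs hiding (sym)
open import Data.Nat using (ℕ; zero; suc; _+_; _*_; _∸_; _≤_; z≤n; s≤s; _≤?_)
import Data.Nat as ℕ
open import Data.Nat.Properties
  using (≤-refl; ≤-reflexive; ≤-trans; m≤m+n; m≤n+m; +-comm; +-suc; *-comm; *-zeroʳ; *-identityʳ;
         +-mono-≤; +-monoˡ-≤; +-monoʳ-≤; *-monoʳ-≤; +-*-semiring; module ≤-Reasoning)
open import Data.Nat.Tactic.RingSolver using (solve)
open import Data.Fin using (Fin; zero; suc)
open import Data.Fin.Properties using (_≟_; suc-injective)
open import Data.Bool using (if_then_else_)
open import Data.List using (_∷_; [])
open import Data.Product using (_×_; _,_; proj₁; proj₂; ∃-syntax; Σ-syntax)
open import Data.Sum using (_⊎_; inj₁; inj₂)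
open import Function using (_∘_; id)
open import Function.Definitions using (Injective)
open import Relation.Nullary using (Dec; yes; no; does; ¬_; _⊎-dec_; contradiction; ¬¬-map)
open import Relation.Nullary.Decidable using (decidable-stable; ¬¬-excluded-middle)
open import Relation.Unary using (Pred; Decidable)
open import Relation.Binary.PropositionalEquality
  using (_≡_; _≢_; refl; sym; trans; cong; cong₂; subst; module ≡-Reasoning)
open import Algebra.Properties.Semiring.Sum +-*-semiring
  using (sum; sum-syntax; sum-cong-≗; ∑-comm; ∑-distrib-+; *-distribˡ-sum)

sum-mono-≤ : ∀ {m} {f g : Fin m → ℕ} → (∀ i → f i ≤ g i) → sum f ≤ sum g
sum-mono-≤ {zero}  f≤g = z≤n
sum-mono-≤ {suc m} f≤g = +-mono-≤ (f≤g zero) (sum-mono-≤ (f≤g ∘ suc))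

sum-const : ∀ m (x : ℕ) → ∑[ i < m ] x ≡ m * x
sum-const zero    x = refl
sum-const (suc m) x = cong (x +_) (sum-const m x)

lookup≤sum : ∀ {m} (f : Fin m → ℕ) i → f i ≤ sum f
lookup≤sum f zero    = m≤m+n _ _
lookup≤sum f (suc i) = ≤-trans (lookup≤sum (f ∘ suc) i) (m≤n+m _ _)

lookup+lookup≤sum : ∀ {m} (f : Fin m → ℕ) {i j} → i ≢ j → f i + f j ≤ sum f
lookup+lookup≤sum f {zero}  {zero}  i≢j = contradiction refl i≢j
lookup+lookup≤sum f {zero}  {suc j} _   = +-monoʳ-≤ (f zero) (lookup≤sum (f ∘ suc) j)
lookup+lookup≤sum f {suc i} {zero}  _   =
  subst (_≤ sum f) (+-comm (f zero) (f (suc i))) (lookup+lookup≤sum f {zero} {suc i} λ ())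
lookup+lookup≤sum f {suc i} {suc j} i≢j =
  ≤-trans (lookup+lookup≤sum (f ∘ suc) (i≢j ∘ cong suc)) (m≤n+m _ _)

-- Only `does` is inspected, so that 𝟙 (suc x ≟ suc y) and 𝟙 (no _ ⊎-dec d) reduce to
-- 𝟙 (x ≟ y) and 𝟙 d.
𝟙 : ∀ {a} {A : Set a} → Dec A → ℕ
𝟙 a? = if does a? then 1 else 0

𝟙-yes : ∀ {a} {A : Set a} (a? : Dec A) → A → 𝟙 a? ≡ 1
𝟙-yes (yes _) _ = refl
𝟙-yes (no ¬a) a = contradiction a ¬a

count : ∀ {N p} {P : Pred (Fin N) p} → Decidable P → ℕ
count P? = ∑[ x < _ ] 𝟙 (P? x)

module _ {N p} {P : Pred (Fin N) p} (P? : Decidable P) where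

  count≥1 : ∀ {x} → P x → 1 ≤ count P?
  count≥1 {x} px = subst (_≤ count P?) (𝟙-yes (P? x) px) (lookup≤sum _ x)

  count≤1⇒unique : count P? ≤ 1 → ∀ {x y} → P x → P y → x ≡ y
  count≤1⇒unique count≤1 {x} {y} px py with x ≟ y
  ... | yes x≡y = x≡y
  ... | no x≢y  = contradiction (≤-trans 2≤count count≤1) (λ { (s≤s ()) })
    where
    2≤count : 2 ≤ count P?
    2≤count = subst (_≤ count P?) (cong₂ _+_ (𝟙-yes (P? x) px) (𝟙-yes (P? y) py))
                (lookup+lookup≤sum _ x≢y)

enumerate : ∀ {N p} {P : Pred (Fin N) p} (P? : Decidable P) →
            Σ[ e ∈ (Fin (count P?) → Fin N) ] Injective _≡_ _≡_ e × (∀ i → P (e i))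
enumerate {zero}  P? = (λ ()) , (λ { {()} }) , (λ ())
enumerate {suc N} {P = P} P? with P? zero | enumerate (P? ∘ suc)
... | no _    | e , e-inj , e∈P = suc ∘ e , e-inj ∘ suc-injective , e∈P
... | yes p₀  | e , e-inj , e∈P = e′ , e′-inj , e′∈P
  where
  e′ : Fin (suc (count (P? ∘ suc))) → Fin (suc N)
  e′ zero    = zero
  e′ (suc i) = suc (e i)
  e′-inj : Injective _≡_ _≡_ e′
  e′-inj {zero}  {zero}  _  = refl
  e′-inj {suc i} {suc j} eq = cong suc (e-inj (suc-injective eq))
  e′∈P : ∀ i → P (e′ i)
  e′∈P zero    = p₀
  e′∈P (suc i) = e∈P i

count-≟ : ∀ {k} (x : Fin k) → count (x ≟_) ≡ 1
count-≟ {suc k} zero    = cong suc (trans (sum-const k 0) (*-zeroʳ k))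
count-≟ {suc k} (suc x) = count-≟ x

count-⊎-≟ : ∀ {a k} {A : Set a} (a? : Dec A) (x : Fin (suc k)) →
            count (λ j → a? ⊎-dec x ≟ j) ≡ 1 + k * 𝟙 a?
count-⊎-≟ {k = k} (yes _) x = sum-const (suc k) 1
count-⊎-≟ {k = k} (no _)  x = trans (count-≟ x) (cong suc (sym (*-zeroʳ k)))

∑-count-fibres : ∀ {n k} (c : Fin n → Fin k) → ∑[ j < k ] count (λ v → c v ≟ j) ≡ n
∑-count-fibres {n} {k} c = begin
  ∑[ j < k ] ∑[ v < n ] 𝟙 (c v ≟ j)  ≡⟨ ∑-comm (λ v j → 𝟙 (c v ≟ j)) ⟨
  ∑[ v < n ] count (c v ≟_)          ≡⟨ sum-cong-≗ (count-≟ ∘ c) ⟩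
  ∑[ v < n ] 1                       ≡⟨ sum-const n 1 ⟩
  n * 1                              ≡⟨ *-identityʳ n ⟩
  n                                  ∎
  where open ≡-Reasoning

2≤m+[m≡1] : ∀ {m} → 1 ≤ m → 2 ≤ m + 𝟙 (m ℕ.≟ 1)
2≤m+[m≡1] {suc zero}    _ = ≤-refl
2≤m+[m≡1] {suc (suc m)} _ = s≤s (s≤s z≤n)

¬¬-∀-Fin : ∀ {N p} {P : Pred (Fin N) p} → (∀ x → ¬ ¬ P x) → ¬ ¬ (∀ x → P x)
¬¬-∀-Fin {zero}  _   ¬∀P = ¬∀P λ ()
¬¬-∀-Fin {suc N} ¬¬P ¬∀P =
  ¬¬P zero λ p₀ → ¬¬-∀-Fin (¬¬P ∘ suc) λ pₛ → ¬∀P λ { zero → p₀ ; (suc x) → pₛ x }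

module _ {n} (G : Graph n) where

  ¬¬-decidable-Adj : ¬ ¬ (∀ u v → Dec (Adj G u v))
  ¬¬-decidable-Adj = ¬¬-∀-Fin λ u → ¬¬-∀-Fin λ v → ¬¬-excluded-middle

  module _ {ω} (ω-max : ∀ m → HasClique G m → m ≤ ω) where

    count≤ω : ∀ {N p} {P : Pred (Fin N) p} (P? : Decidable P) (g : Fin N → Fin n) →
              Injective _≡_ _≡_ g → (∀ {x y} → P x → P y → x ≢ y → Adj G (g x) (g y)) →
              count P? ≤ ω
    count≤ω P? g g-inj g-adj with enumerate P?
    ... | e , e-inj , e∈P =
      ω-max _ (g ∘ e , e-inj ∘ g-inj , λ i j i≢j → g-adj (e∈P i) (e∈P j) (i≢j ∘ e-inj))

  module _ (Adj? : ∀ u v → Dec (Adj G u v)) {k q} (q-proper : IsProperColoring (complement G) k q) where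

    sameColor⇒adjacent : ∀ {u v} → u ≢ v → q u ≡ q v → Adj G u v
    sameColor⇒adjacent {u} {v} u≢v qu≡qv =
      decidable-stable (Adj? u v) λ ¬uv → q-proper u v (u≢v , ¬uv) qu≡qv

    n≤k*ω : ∀ {ω} → (∀ m → HasClique G m → m ≤ ω) → n ≤ k * ω
    n≤k*ω {ω} ω-max = begin
      n                                 ≡⟨ ∑-count-fibres q ⟨
      ∑[ j < k ] count (λ v → q v ≟ j)  ≤⟨ sum-mono-≤ class≤ω ⟩
      ∑[ j < k ] ω                      ≡⟨ sum-const k ω ⟩
      k * ω                             ∎
      where
      open ≤-Reasoning
      class≤ω : ∀ j → count (λ v → q v ≟ j) ≤ ω
      class≤ω j = count≤ω ω-max (λ v → q v ≟ j) id id λ qu≡j qv≡j u≢v →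
        sameColor⇒adjacent u≢v (trans qu≡j (sym qv≡j))

module BColoring {n} (G : Graph n) {b} {c : Fin n → Fin b} (c-isB : IsBColoring G b c) where

  dominant : Fin b → Fin n
  dominant i = proj₁ (proj₂ (proj₂ c-isB) i)

  color-dominant : ∀ i → c (dominant i) ≡ i
  color-dominant i = proj₁ (proj₂ (proj₂ (proj₂ c-isB) i))

  dominant-sees : ∀ i j → j ≢ i → ∃[ u ] Adj G (dominant i) u × c u ≡ j
  dominant-sees i = proj₂ (proj₂ (proj₂ (proj₂ c-isB) i))

  dominant-injective : Injective _≡_ _≡_ dominant
  dominant-injective {i} {j} eq =
    trans (sym (color-dominant i)) (trans (cong c eq) (color-dominant j))

  classSize : Fin b → ℕ
  classSize i = count (λ v → c v ≟ i)

  Singleton : Fin b → Set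
  Singleton i = classSize i ≡ 1

  singleton? : Decidable Singleton
  singleton? i = classSize i ℕ.≟ 1

  singleton-unique : ∀ {i u} → Singleton i → c u ≡ i → u ≡ dominant i
  singleton-unique {i} singleton cu≡i =
    count≤1⇒unique (λ v → c v ≟ i) (≤-reflexive singleton) cu≡i (color-dominant i)

  singleton-adjacent : ∀ {i j} → Singleton i → j ≢ i → Adj G (dominant j) (dominant i)
  singleton-adjacent {i} {j} singleton j≢i with dominant-sees j i (j≢i ∘ sym)
  ... | u , adj , cu≡i = subst (Adj G (dominant j)) (singleton-unique singleton cu≡i) adj

  2b≤n+singletons : 2 * b ≤ n + count singleton?
  2b≤n+singletons = begin
    2 * b                                         ≡⟨ *-comm 2 b ⟩
    b * 2                                         ≡⟨ sum-const b 2 ⟨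
    ∑[ i < b ] 2                                  ≤⟨ sum-mono-≤ (λ i → 2≤m+[m≡1] (classSize≥1 i)) ⟩
    ∑[ i < b ] (classSize i + 𝟙 (singleton? i))  ≡⟨ ∑-distrib-+ classSize (𝟙 ∘ singleton?) ⟩
    sum classSize + count singleton?              ≡⟨ cong (_+ count singleton?) (∑-count-fibres c) ⟩
    n + count singleton?                          ∎
    where
    open ≤-Reasoning
    classSize≥1 : ∀ i → 1 ≤ classSize i
    classSize≥1 i = count≥1 (λ v → c v ≟ i) (color-dominant i)

  module _ (Adj? : ∀ u v → Dec (Adj G u v))
           {k q} (q-proper : IsProperColoring (complement G) (suc k) q)
           {ω} (ω-max : ∀ m → HasClique G m → m ≤ ω) where

    b+k*singletons≤[1+k]*ω : b + k * count singleton? ≤ suc k * ω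
    b+k*singletons≤[1+k]*ω = begin
      b + k * count singleton?
        ≡⟨ cong₂ _+_ b≡∑1 (*-distribˡ-sum k (𝟙 ∘ singleton?)) ⟩
      ∑[ i < b ] 1 + ∑[ i < b ] (k * 𝟙 (singleton? i))
        ≡⟨ ∑-distrib-+ (λ _ → 1) (λ i → k * 𝟙 (singleton? i)) ⟨
      ∑[ i < b ] (1 + k * 𝟙 (singleton? i))
        ≡⟨ sum-cong-≗ (λ i → count-⊎-≟ (singleton? i) (q (dominant i))) ⟨
      ∑[ i < b ] ∑[ j < suc k ] 𝟙 (cliqueMember? j i)
        ≡⟨ ∑-comm (λ i j → 𝟙 (cliqueMember? j i)) ⟩
      ∑[ j < suc k ] count (cliqueMember? j)
        ≤⟨ sum-mono-≤ cliqueMembers≤ω ⟩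
      ∑[ j < suc k ] ω
        ≡⟨ sum-const (suc k) ω ⟩
      suc k * ω
        ∎
      where
      open ≤-Reasoning
      b≡∑1 : b ≡ ∑[ i < b ] 1
      b≡∑1 = trans (sym (*-identityʳ b)) (sym (sum-const b 1))
      cliqueMember? : ∀ j i → Dec (Singleton i ⊎ q (dominant i) ≡ j)
      cliqueMember? j i = singleton? i ⊎-dec q (dominant i) ≟ j
      cliqueMembers≤ω : ∀ j → count (cliqueMember? j) ≤ ω
      cliqueMembers≤ω j = count≤ω G ω-max (cliqueMember? j) dominant dominant-injective adjacent
        where
        adjacent : ∀ {x y} → Singleton x ⊎ q (dominant x) ≡ j → Singleton y ⊎ q (dominant y) ≡ j →
                   x ≢ y → Adj G (dominant x) (dominant y)
        adjacent (inj₁ singleton-x) _                  x≢y =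
          Graph.sym G (singleton-adjacent singleton-x (x≢y ∘ sym))
        adjacent (inj₂ _)           (inj₁ singleton-y) x≢y = singleton-adjacent singleton-y x≢y
        adjacent (inj₂ qx≡j)        (inj₂ qy≡j)        x≢y =
          sameColor⇒adjacent G Adj? q-proper (x≢y ∘ dominant-injective) (trans qx≡j (sym qy≡j))

counting-bounds⇒b*[2k+1]≤[k+1]²ω : ∀ {b n s k ω} →
  2 * b ≤ n + s → b + k * s ≤ suc k * ω → n ≤ suc k * ω →
  b * (2 * suc k ∸ 1) ≤ suc k * suc k * ω
counting-bounds⇒b*[2k+1]≤[k+1]²ω {b} {n} {s} {k} {ω} 2b≤n+s b+ks≤[1+k]ω n≤[1+k]ω = begin
  b * (2 * suc k ∸ 1)          ≡⟨ cong (b *_) (+-suc k (k + 0)) ⟩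
  b * (1 + 2 * k)              ≡⟨ solve (b ∷ k ∷ []) ⟩
  k * (2 * b) + b              ≤⟨ +-monoˡ-≤ b (*-monoʳ-≤ k 2b≤n+s) ⟩
  k * (n + s) + b              ≡⟨ solve (k ∷ n ∷ s ∷ b ∷ []) ⟩
  k * n + (b + k * s)          ≤⟨ +-mono-≤ (*-monoʳ-≤ k n≤[1+k]ω) b+ks≤[1+k]ω ⟩
  k * (suc k * ω) + suc k * ω  ≡⟨ solve (k ∷ ω ∷ []) ⟩
  suc k * suc k * ω            ∎
  where open ≤-Reasoning

corollary2 : ∀ (n : ℕ) (G : Graph n) (φ ω k : ℕ) →
    IsBChromaticNumber G φ → IsCliqueNumber G ω → IsChromaticNumber (complement G) k →
    φ * (2 * k ∸ 1) ≤ k * k * ω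
corollary2 n G φ ω zero    _ _ _ = ≤-reflexive (*-zeroʳ φ)
corollary2 n G φ ω (suc k) ((c , c-isB) , _) (_ , ω-max) ((q , q-proper) , _) =
  -- Adjacency need not be decidable, but the goal is, so we may decide adjacency under ¬¬.
  decidable-stable (_ ≤? _) (¬¬-map bound (¬¬-decidable-Adj G))
  where
  open BColoring G c-isB
  bound : (∀ u v → Dec (Adj G u v)) → φ * (2 * suc k ∸ 1) ≤ suc k * suc k * ω
  bound Adj? = counting-bounds⇒b*[2k+1]≤[k+1]²ω {φ} {k = k} {ω}
    2b≤n+singletons
    (b+k*singletons≤[1+k]*ω Adj? q-proper ω-max)
    (n≤k*ω G Adj? q-proper ω-max)
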